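{- Let $u,v\in X^*$ be two words, let $I_1,J_1$ be disjoint with $I_1\cup J_1=[1\dots|u|]$, and let $I_2,J_2$ be disjoint with $I_2\cup J_2=[|u|+1\dots|u|+|v|]$. Let $I'_2=\{k-|u|:k\in I_2\}$ and $J'_2=\{k-|u|:k\in J_2\}$. Then $$pack\Big({}^{(u*v)[J_1\cup J_2]}/_{(u*v)[I_1\cup I_2]}\Big)=pack\big({}^{u[J_1]}/_{u[I_1]}\big)*pack\big({}^{v[J'_2]}/_{v[I'_2]}\big).$$
   Context: Let $X=\{x_i\}_{i\ge 0}$ be an alphabet indexed by the nonnegative integers and $X^*$ the set of words over $X$. For a word $w=x_{i_1}\cdots x_{i_m}$, $|w|=m$, $w[j]$ is its $j$-th letter, $Alph(w)$ the set of letters occurring in $w$, $IAlph(w)=\{i_1,\dots,i_m\}$, and $sup(w)=\max IAlph(w)$ ($sup(w)=0$ if $IAlph(w)=\emptyset$). For $\phi$ on $IAlph(w)$ with values in $\mathbb{N}$ and $\phi(0)=0$, $S_\phi(w)=x_{\phi(i_1)}\cdots x_{\phi(i_m)}$. If $IAlph(w)\setminus\{0\}=\{j_1<\dots<j_k\}$, let $\phi_w(j_m)=m$, $\phi_w(0)=0$, $pack(w)=S_{\phi_w}(w)$. For $t\in\mathbb{N}$, $T_t(w)=S_\phi(w)$ with $\phi(0)=0$, $\phi(n)=n+t$ for $n>0$. Shifted concatenation: $u*v=u\,T_{sup(u)}(v)$. For $L=\{l_1<\dots<l_r\}\subseteq[1\dots|w|]$, $w[L]=w[l_1]\cdots w[l_r]$.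 For $A\subseteq X$, $w/A=S_{\phi_A}(w)$ where $\phi_A(i)=0$ if $x_i\in A$ and $\phi_A(i)=i$ otherwise; for words $w,u$, ${}^{w}/_{u}=w/Alph(u)$. -}

module Defs where

open import Data.Nat using (ℕ; zero; suc; _+_; _⊔_; _≤_; _∸_; _≡ᵇ_; _≤ᵇ_)
open import Data.Bool using (Bool; true; false; if_then_else_; _∨_; _∧_)
open import Data.List using (List; []; _∷_; _++_; map; foldr)
open import Data.Bool.ListAction using (any)

-- A letter x_i is represented by its index i : ℕ; a word over X is a list of indices.
Word : Set
Word = List ℕ

-- A (decidable) set of positions, positions being 1-based natural numbers.
PosSet : Set
PosSet = ℕ → Bool

sup : Word → ℕ
sup = foldr _⊔_ 0

occurs : ℕ → Word → Bool
occurs i w = any (λ j → i ≡ᵇ j) w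

T : ℕ → Word → Word
T t = map (λ n → if n ≡ᵇ 0 then 0 else n + t)

infixl 6 _⋆_
_⋆_ : Word → Word → Word
u ⋆ v = u ++ T (sup u) v

selectFrom : ℕ → PosSet → Word → Word
selectFrom k L [] = []
selectFrom k L (a ∷ w) = if L k then a ∷ selectFrom (suc k) L w else selectFrom (suc k) L w

_[_] : Word → PosSet → Word
w [ L ] = selectFrom 1 L w

_/_ : Word → Word → Word
w / u = map (λ i → if occurs i u then 0 else i) w

rank : Word → ℕ → ℕ
rank w zero = 0
rank w (suc j) = rank w j + (if occurs (suc j) w then 1 else 0)

pack : Word → Word
pack w = map (λ i → if i ≡ᵇ 0 then 0 else rank w i) w

_∪_ : PosSet → PosSet → PosSet
(A ∪ B) k = A k ∨ B k

shiftDown : ℕ → PosSet → PosSet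
shiftDown n A k = A (k + n)

interval : ℕ → ℕ → PosSet
interval a b k = (a ≤ᵇ k) ∧ (k ≤ᵇ b)

-- Both selections from u ⋆ v split as a selection from u followed by T_{sup u} of the
-- corresponding selection from v. The letters of the u-part are at most sup u, while the
-- nonzero letters of the T_{sup u}-part exceed it, so erasure acts on the two parts
-- independently. For the same reason, in pack (A ++ T_s B) with A bounded by s, the rank
-- of a letter i ≤ s is its rank in A, and the rank of i + s is rank_A(s) + rank_B(i),
-- where rank_A(s) = sup (pack A): this is exactly pack A ⋆ pack B.
module Submission where

open import Defs
open import Data.Nat using (ℕ; zero; suc; _+_; _≤_; _<_; _≤′_; ≤′-refl; ≤′-step; _≡ᵇ_; _≤ᵇ_; z≤n; s≤s; z<s)
open import Data.Nat.Properties
open import Data.Bool using (true; false; if_then_else_; _∧_; _∨_)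
open import Data.Bool.Properties using (∧-zeroʳ; ∨-identityʳ; ∨-zeroʳ; ∨-conicalˡ; ∨-conicalʳ; if-eta)
open import Data.List using ([]; _∷_; _++_; map; length)
open import Data.List.Properties using (map-++; map-∘; map-cong; map-cong-local)
open import Data.List.Relation.Unary.All as All using (All; []; _∷_)
open import Data.List.Relation.Unary.All.Properties using (map⁺)
open import Data.Product using (_×_; _,_; proj₁; proj₂)
open import Relation.Nullary using (¬_; yes; no)
open import Relation.Nullary.Decidable using (dec-true; dec-false)
open import Relation.Binary.PropositionalEquality
  using (_≡_; _≢_; refl; sym; trans; cong; cong₂; module ≡-Reasoning)

open ≡-Reasoning

≡ᵇ-refl : ∀ n → (n ≡ᵇ n) ≡ true
≡ᵇ-refl n = dec-true (n ≟ n) refl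

≢⇒≡ᵇ-false : ∀ {m n} → m ≢ n → (m ≡ᵇ n) ≡ false
≢⇒≡ᵇ-false {m} {n} = dec-false (m ≟ n)

≰⇒≤ᵇ-false : ∀ {m n} → ¬ m ≤ n → (m ≤ᵇ n) ≡ false
≰⇒≤ᵇ-false {m} {n} = dec-false (m ≤? n)

+-≡ᵇ-+ˡ : ∀ s a b → (s + a ≡ᵇ s + b) ≡ (a ≡ᵇ b)
+-≡ᵇ-+ˡ zero    a b = refl
+-≡ᵇ-+ˡ (suc s) a b = +-≡ᵇ-+ˡ s a b

+-≡ᵇ-+ʳ : ∀ s a b → (a + s ≡ᵇ b + s) ≡ (a ≡ᵇ b)
+-≡ᵇ-+ʳ s a b rewrite +-comm a s | +-comm b s = +-≡ᵇ-+ˡ s a b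

-- T t, _/ u and pack w are, definitionally, map of the following letter maps.
shiftLetter : ℕ → ℕ → ℕ
shiftLetter t n = if n ≡ᵇ 0 then 0 else n + t

eraseLetter : Word → ℕ → ℕ
eraseLetter u i = if occurs i u then 0 else i

packLetter : Word → ℕ → ℕ
packLetter w i = if i ≡ᵇ 0 then 0 else rank w i

interval-below : ∀ {a b k} → k < a → interval a b k ≡ false
interval-below {a} {b} {k} k<a rewrite ≰⇒≤ᵇ-false {a} {k} (<⇒≱ k<a) = refl

interval-above : ∀ {a b k} → b < k → interval a b k ≡ false
interval-above {a} {b} {k} b<k rewrite ≰⇒≤ᵇ-false {k} {b} (<⇒≱ b<k) = ∧-zeroʳ (a ≤ᵇ k)

cover-outside : ∀ {I J : PosSet} {a b i} → (∀ k → I k ∨ J k ≡ interval a b k) →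
                interval a b i ≡ false → I i ≡ false × J i ≡ false
cover-outside {I} {J} {i = i} cover outside =
  ∨-conicalˡ (I i) (J i) I∨J≡false , ∨-conicalʳ (I i) (J i) I∨J≡false
  where
  I∨J≡false : I i ∨ J i ≡ false
  I∨J≡false = trans (cover i) outside

selectFrom-++ : ∀ k L (xs ys : Word) →
                selectFrom k L (xs ++ ys) ≡ selectFrom k L xs ++ selectFrom (k + length xs) L ys
selectFrom-++ k L [] ys = cong (λ j → selectFrom j L ys) (sym (+-identityʳ k))
selectFrom-++ k L (x ∷ xs) ys rewrite +-suc k (length xs) with L k
... | true  = cong (x ∷_) (selectFrom-++ (suc k) L xs ys)
... | false = selectFrom-++ (suc k) L xs ys

selectFrom-cong : ∀ k {L L' : PosSet} (w : Word) →
                  (∀ i → k ≤ i → i < k + length w → L i ≡ L' i) →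
                  selectFrom k L w ≡ selectFrom k L' w
selectFrom-cong k [] _ = refl
selectFrom-cong k {L} {L'} (x ∷ w) agree =
  cong₂ (λ b r → if b then x ∷ r else r)
        (agree k ≤-refl (m<m+n k z<s))
        (selectFrom-cong (suc k) w agree-after)
  where
  agree-after : ∀ i → suc k ≤ i → i < suc k + length w → L i ≡ L' i
  agree-after i k<i i<end = agree i (<⇒≤ k<i) (≤-trans i<end (≤-reflexive (sym (+-suc k (length w)))))

selectFrom-map : ∀ k L f (w : Word) → selectFrom k L (map f w) ≡ map f (selectFrom k L w)
selectFrom-map k L f [] = refl
selectFrom-map k L f (x ∷ w) with L k
... | true  = cong (f x ∷_) (selectFrom-map (suc k) L f w)
... | false = selectFrom-map (suc k) L f w

selectFrom-shiftDown : ∀ k n L (w : Word) → selectFrom k (shiftDown n L) w ≡ selectFrom (k + n) L w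
selectFrom-shiftDown k n L [] = refl
selectFrom-shiftDown k n L (x ∷ w) with L (k + n)
... | true  = cong (x ∷_) (selectFrom-shiftDown (suc k) n L w)
... | false = selectFrom-shiftDown (suc k) n L w

All-selectFrom : ∀ {P : ℕ → Set} k L (w : Word) → All P w → All P (selectFrom k L w)
All-selectFrom k L [] [] = []
All-selectFrom k L (x ∷ w) (px ∷ pw) with L k
... | true  = px ∷ All-selectFrom (suc k) L w pw
... | false = All-selectFrom (suc k) L w pw

All≤sup : ∀ (w : Word) → All (_≤ sup w) w
All≤sup [] = []
All≤sup (x ∷ w) = m≤m⊔n x (sup w) ∷ All.map (λ p → ≤-trans p (m≤n⊔m x (sup w))) (All≤sup w)

sup-lub : ∀ {m} {w : Word} → All (_≤ m) w → sup w ≤ m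
sup-lub []       = z≤n
sup-lub (p ∷ ps) = ⊔-lub p (sup-lub ps)

occurs⇒≤sup-map : ∀ f x (w : Word) → occurs x w ≡ true → f x ≤ sup (map f w)
occurs⇒≤sup-map f x (y ∷ w) occ with x ≟ y
... | yes refl = m≤m⊔n (f x) _
... | no x≢y rewrite ≢⇒≡ᵇ-false x≢y = ≤-trans (occurs⇒≤sup-map f x w occ) (m≤n⊔m (f y) _)

All-occurs : ∀ (w : Word) → All (λ x → occurs x w ≡ true) w
All-occurs [] = []
All-occurs (x ∷ w) =
  cong (_∨ occurs x w) (≡ᵇ-refl x)
  ∷ All.map (λ {y} occ → trans (cong ((y ≡ᵇ x) ∨_) occ) (∨-zeroʳ (y ≡ᵇ x))) (All-occurs w)

occurs-++ : ∀ i (xs ys : Word) → occurs i (xs ++ ys) ≡ (occurs i xs ∨ occurs i ys)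
occurs-++ i [] ys = refl
occurs-++ i (x ∷ xs) ys with i ≡ᵇ x
... | true  = refl
... | false = occurs-++ i xs ys

occurs-above : ∀ {s x} {w : Word} → All (_≤ s) w → s < x → occurs x w ≡ false
occurs-above [] s<x = refl
occurs-above {x = x} {y ∷ w} (y≤s ∷ w≤s) s<x
  rewrite ≢⇒≡ᵇ-false {x} {y} (λ { refl → <⇒≱ s<x y≤s }) = occurs-above w≤s s<x

occurs-T-low : ∀ s {i} (w : Word) → 0 < i → i ≤ s → occurs i (T s w) ≡ false
occurs-T-low s [] _ _ = refl
occurs-T-low s {i} (zero ∷ w) 0<i i≤s
  rewrite ≢⇒≡ᵇ-false {i} {0} (>⇒≢ 0<i) = occurs-T-low s w 0<i i≤s
occurs-T-low s {i} (suc y ∷ w) 0<i i≤s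
  rewrite ≢⇒≡ᵇ-false {i} {suc y + s} (λ { refl → <⇒≱ (s≤s (m≤n+m s y)) i≤s }) = occurs-T-low s w 0<i i≤s

occurs-T-shifted : ∀ s j (w : Word) → occurs (suc j + s) (T s w) ≡ occurs (suc j) w
occurs-T-shifted s j [] = refl
occurs-T-shifted s j (zero ∷ w) = occurs-T-shifted s j w
occurs-T-shifted s j (suc y ∷ w)
  rewrite +-≡ᵇ-+ʳ s (suc j) (suc y) = cong ((j ≡ᵇ y) ∨_) (occurs-T-shifted s j w)

occurs-++-T-low : ∀ s {i} (A B : Word) → 0 < i → i ≤ s → occurs i (A ++ T s B) ≡ occurs i A
occurs-++-T-low s {i} A B 0<i i≤s = begin
  occurs i (A ++ T s B)         ≡⟨ occurs-++ i A (T s B) ⟩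
  occurs i A ∨ occurs i (T s B) ≡⟨ cong (occurs i A ∨_) (occurs-T-low s B 0<i i≤s) ⟩
  occurs i A ∨ false            ≡⟨ ∨-identityʳ (occurs i A) ⟩
  occurs i A                    ∎

occurs-++-T-high : ∀ s j {A : Word} (B : Word) → All (_≤ s) A →
                   occurs (suc j + s) (A ++ T s B) ≡ occurs (suc j) B
occurs-++-T-high s j {A} B A≤s = begin
  occurs (suc j + s) (A ++ T s B)                 ≡⟨ occurs-++ (suc j + s) A (T s B) ⟩
  occurs (suc j + s) A ∨ occurs (suc j + s) (T s B)
    ≡⟨ cong₂ _∨_ (occurs-above A≤s (s≤s (m≤n+m s j))) (occurs-T-shifted s j B) ⟩
  occurs (suc j) B                                ∎

eraseLetter≤ : ∀ u i → eraseLetter u i ≤ i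
eraseLetter≤ u i with occurs i u
... | true  = z≤n
... | false = ≤-refl

/-bounded : ∀ {s} {A : Word} (B : Word) → All (_≤ s) A → All (_≤ s) (A / B)
/-bounded B A≤s = map⁺ (All.map (λ {x} x≤s → ≤-trans (eraseLetter≤ B x) x≤s) A≤s)

/-++-T : ∀ s {A B : Word} (C D : Word) → All (_≤ s) A → All (_≤ s) B →
         (A ++ T s C) / (B ++ T s D) ≡ (A / B) ++ T s (C / D)
/-++-T s {A} {B} C D A≤s B≤s = begin
  map erase (A ++ T s C)                  ≡⟨ map-++ erase A (T s C) ⟩
  map erase A ++ map erase (T s C)        ≡⟨ cong₂ _++_ (map-cong-local (All.map erase-low A≤s)) erase-shifted ⟩
  (A / B) ++ T s (C / D)                  ∎
  where
  erase : ℕ → ℕ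
  erase = eraseLetter (B ++ T s D)

  erase-low : ∀ {x} → x ≤ s → erase x ≡ eraseLetter B x
  erase-low {zero}  _   = trans (if-eta (occurs 0 (B ++ T s D))) (sym (if-eta (occurs 0 B)))
  erase-low {suc x} x≤s = cong (λ b → if b then 0 else suc x) (occurs-++-T-low s B D z<s x≤s)

  erase-shift : ∀ c → erase (shiftLetter s c) ≡ shiftLetter s (eraseLetter D c)
  erase-shift zero = trans (if-eta (occurs 0 (B ++ T s D))) (sym (cong (shiftLetter s) (if-eta (occurs 0 D))))
  erase-shift (suc j) rewrite occurs-++-T-high s j D B≤s with occurs (suc j) D
  ... | true  = refl
  ... | false = refl

  erase-shifted : map erase (T s C) ≡ T s (C / D)
  erase-shifted = begin
    map erase (map (shiftLetter s) C)              ≡⟨ map-∘ C ⟨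
    map (λ c → erase (shiftLetter s c)) C          ≡⟨ map-cong erase-shift C ⟩
    map (λ c → shiftLetter s (eraseLetter D c)) C  ≡⟨ map-∘ C ⟩
    T s (C / D)                                    ∎

rank-mono : ∀ (w : Word) {i j} → i ≤ j → rank w i ≤ rank w j
rank-mono w i≤j = mono′ (≤⇒≤′ i≤j)
  where
  mono′ : ∀ {i j} → i ≤′ j → rank w i ≤ rank w j
  mono′ ≤′-refl          = ≤-refl
  mono′ (≤′-step i≤′j)   = ≤-trans (mono′ i≤′j) (m≤m+n _ _)

rank-occurs : ∀ (w : Word) j → occurs (suc j) w ≡ true → rank w (suc j) ≡ suc (rank w j)
rank-occurs w j occ rewrite occ = +-comm (rank w j) 1

rank≤sup-pack : ∀ (w : Word) i → rank w i ≤ sup (pack w)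
rank≤sup-pack w zero = z≤n
rank≤sup-pack w (suc i) with occurs (suc i) w in occ | occurs⇒≤sup-map (packLetter w) (suc i) w
... | false | _    = ≤-trans (≤-reflexive (+-identityʳ (rank w i))) (rank≤sup-pack w i)
... | true  | ≤sup = ≤sup refl

sup-pack : ∀ {s} {A : Word} → All (_≤ s) A → sup (pack A) ≡ rank A s
sup-pack {s} {A} A≤s = ≤-antisym (sup-lub (map⁺ (All.map packLetter≤ A≤s))) (rank≤sup-pack A s)
  where
  packLetter≤ : ∀ {x} → x ≤ s → packLetter A x ≤ rank A s
  packLetter≤ {zero}  _   = z≤n
  packLetter≤ {suc x} x≤s = rank-mono A x≤s

rank-++-T-low : ∀ s (A B : Word) {i} → i ≤ s → rank (A ++ T s B) i ≡ rank A i
rank-++-T-low s A B {zero}  _   = refl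
rank-++-T-low s A B {suc i} i<s =
  cong₂ _+_ (rank-++-T-low s A B (<⇒≤ i<s))
            (cong (λ b → if b then 1 else 0) (occurs-++-T-low s A B z<s i<s))

rank-++-T-high : ∀ s {A : Word} (B : Word) → All (_≤ s) A →
                 ∀ m → rank (A ++ T s B) (m + s) ≡ rank A s + rank B m
rank-++-T-high s {A} B A≤s zero =
  trans (rank-++-T-low s A B ≤-refl) (sym (+-identityʳ (rank A s)))
rank-++-T-high s {A} B A≤s (suc m) = begin
  rank (A ++ T s B) (m + s) + (if occurs (suc m + s) (A ++ T s B) then 1 else 0)
    ≡⟨ cong₂ _+_ (rank-++-T-high s B A≤s m)
                 (cong (λ b → if b then 1 else 0) (occurs-++-T-high s m B A≤s)) ⟩
  rank A s + rank B m + (if occurs (suc m) B then 1 else 0)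
    ≡⟨ +-assoc (rank A s) (rank B m) _ ⟩
  rank A s + rank B (suc m)
    ∎

pack-++-T : ∀ s {A : Word} (B : Word) → All (_≤ s) A → pack (A ++ T s B) ≡ pack A ⋆ pack B
pack-++-T s {A} B A≤s = begin
  map pk (A ++ T s B)           ≡⟨ map-++ pk A (T s B) ⟩
  map pk A ++ map pk (T s B)    ≡⟨ cong₂ _++_ (map-cong-local (All.map pack-low A≤s)) pack-shifted ⟩
  pack A ⋆ pack B               ∎
  where
  pk : ℕ → ℕ
  pk = packLetter (A ++ T s B)

  pack-low : ∀ {x} → x ≤ s → pk x ≡ packLetter A x
  pack-low {zero}  _   = refl
  pack-low {suc x} x≤s = rank-++-T-low s A B x≤s

  pack-shift : ∀ {c} → occurs c B ≡ true →
               pk (shiftLetter s c) ≡ shiftLetter (sup (pack A)) (packLetter B c)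
  pack-shift {zero}  _   = refl
  pack-shift {suc j} occ = begin
    rank (A ++ T s B) (suc j + s)               ≡⟨ rank-++-T-high s B A≤s (suc j) ⟩
    rank A s + rank B (suc j)                   ≡⟨ +-comm (rank A s) (rank B (suc j)) ⟩
    rank B (suc j) + rank A s                   ≡⟨ cong₂ _+_ (rank-occurs B j occ) (sym (sup-pack A≤s)) ⟩
    suc (rank B j) + sup (pack A)               ≡⟨ cong (shiftLetter (sup (pack A))) (rank-occurs B j occ) ⟨
    shiftLetter (sup (pack A)) (rank B (suc j)) ∎

  pack-shifted : map pk (T s B) ≡ T (sup (pack A)) (pack B)
  pack-shifted = begin
    map pk (map (shiftLetter s) B)                                   ≡⟨ map-∘ {g = pk} {f = shiftLetter s} B ⟨
    map (λ c → pk (shiftLetter s c)) B                               ≡⟨ map-cong-local (All.map (λ {c} → pack-shift {c}) (All-occurs B)) ⟩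
    map (λ c → shiftLetter (sup (pack A)) (packLetter B c)) B        ≡⟨ map-∘ B ⟩
    T (sup (pack A)) (pack B)                                        ∎

select-⋆ : ∀ (u v : Word) (K₁ K₂ : PosSet) →
           (∀ i → length u < i → K₁ i ≡ false) → (∀ i → i ≤ length u → K₂ i ≡ false) →
           (u ⋆ v) [ K₁ ∪ K₂ ] ≡ (u [ K₁ ]) ++ T (sup u) (v [ shiftDown (length u) K₂ ])
select-⋆ u v K₁ K₂ K₁-high K₂-low = begin
  selectFrom 1 (K₁ ∪ K₂) (u ++ T s v)
    ≡⟨ selectFrom-++ 1 (K₁ ∪ K₂) u (T s v) ⟩
  selectFrom 1 (K₁ ∪ K₂) u ++ selectFrom (suc n) (K₁ ∪ K₂) (T s v)
    ≡⟨ cong₂ _++_ (selectFrom-cong 1 u only-K₁) (selectFrom-cong (suc n) (T s v) only-K₂) ⟩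
  selectFrom 1 K₁ u ++ selectFrom (suc n) K₂ (T s v)
    ≡⟨ cong (selectFrom 1 K₁ u ++_) (selectFrom-map (suc n) K₂ (shiftLetter s) v) ⟩
  selectFrom 1 K₁ u ++ T s (selectFrom (suc n) K₂ v)
    ≡⟨ cong (λ w → selectFrom 1 K₁ u ++ T s w) (selectFrom-shiftDown 1 n K₂ v) ⟨
  (u [ K₁ ]) ++ T s (v [ shiftDown n K₂ ])
    ∎
  where
  s = sup u
  n = length u

  only-K₁ : ∀ i → 1 ≤ i → i < suc n → K₁ i ∨ K₂ i ≡ K₁ i
  only-K₁ i _ (s≤s i≤n) = trans (cong (K₁ i ∨_) (K₂-low i i≤n)) (∨-identityʳ (K₁ i))

  only-K₂ : ∀ i → suc n ≤ i → i < suc n + length (T s v) → K₁ i ∨ K₂ i ≡ K₂ i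
  only-K₂ i n<i _ = cong (_∨ K₂ i) (K₁-high i n<i)

lemma5 : (u v : Word) (I₁ J₁ I₂ J₂ : PosSet) →
    (∀ k → I₁ k ∧ J₁ k ≡ false) →
    (∀ k → I₁ k ∨ J₁ k ≡ interval 1 (length u) k) →
    (∀ k → I₂ k ∧ J₂ k ≡ false) →
    (∀ k → I₂ k ∨ J₂ k ≡ interval (suc (length u)) (length u + length v) k) →
    pack (((u ⋆ v) [ J₁ ∪ J₂ ]) / ((u ⋆ v) [ I₁ ∪ I₂ ]))
      ≡ pack ((u [ J₁ ]) / (u [ I₁ ]))
        ⋆ pack ((v [ shiftDown (length u) J₂ ]) / (v [ shiftDown (length u) I₂ ]))
lemma5 u v I₁ J₁ I₂ J₂ _ cover₁ _ cover₂ = begin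
  pack (((u ⋆ v) [ J₁ ∪ J₂ ]) / ((u ⋆ v) [ I₁ ∪ I₂ ]))
    ≡⟨ cong pack (cong₂ _/_ (select-⋆ u v J₁ J₂ J₁-high J₂-low) (select-⋆ u v I₁ I₂ I₁-high I₂-low)) ⟩
  pack ((A ++ T s C) / (B ++ T s D))
    ≡⟨ cong pack (/-++-T s C D A≤s B≤s) ⟩
  pack ((A / B) ++ T s (C / D))
    ≡⟨ pack-++-T s (C / D) (/-bounded B A≤s) ⟩
  pack (A / B) ⋆ pack (C / D)
    ∎
  where
  s = sup u
  n = length u
  A = u [ J₁ ]
  B = u [ I₁ ]
  C = v [ shiftDown n J₂ ]
  D = v [ shiftDown n I₂ ]

  A≤s : All (_≤ s) A
  A≤s = All-selectFrom 1 J₁ u (All≤sup u)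

  B≤s : All (_≤ s) B
  B≤s = All-selectFrom 1 I₁ u (All≤sup u)

  outside₁ : ∀ i → n < i → I₁ i ≡ false × J₁ i ≡ false
  outside₁ i n<i = cover-outside {I₁} {J₁} cover₁ (interval-above {1} {n} n<i)

  outside₂ : ∀ i → i ≤ n → I₂ i ≡ false × J₂ i ≡ false
  outside₂ i i≤n = cover-outside {I₂} {J₂} cover₂ (interval-below {suc n} {n + length v} (s≤s i≤n))

  I₁-high : ∀ i → n < i → I₁ i ≡ false
  I₁-high i n<i = proj₁ (outside₁ i n<i)

  J₁-high : ∀ i → n < i → J₁ i ≡ false
  J₁-high i n<i = proj₂ (outside₁ i n<i)

  I₂-low : ∀ i → i ≤ n → I₂ i ≡ false
  I₂-low i i≤n = proj₁ (outside₂ i i≤n)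

  J₂-low : ∀ i → i ≤ n → J₂ i ≡ false
  J₂-low i i≤n = proj₂ (outside₂ i i≤n)
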